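{- Let $p$ be a prime, $k\ge 0$ an integer, and $G$ a group of order $p^k$. Then for every positive integer $n$, $B_G(n) \le B_{C_{p^k}}(n)$.
   Context: For a finite group $H$, $B_H(n)$ denotes the number of elements of $H$ whose order is at least $n$. $C_{p^k}$ is the cyclic group of order $p^k$. -}

module Defs where

open import Level using (Level; _⊔_)
open import Algebra.Bundles using (Group)
open import Function.Bundles using (Inverse)
open import Data.Nat as ℕ using (ℕ; zero; suc; _≤?_)
open import Data.Fin as Fin using (Fin)
open import Data.List using (List; length; filter; allFin)
open import Data.Product using (∃)
open import Relation.Binary.PropositionalEquality as ≡ using (_≡_)
open import Relation.Nullary using (yes; no)

record FiniteGroup (c ℓ : Level) : Set (Level.suc (c ⊔ ℓ)) where
  field
    group : Group c ℓ
    size  : ℕ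
    enum  : Inverse (Group.setoid group) (≡.setoid (Fin size))
  open Group group public
  open Inverse enum public using (to; from)

module _ {c ℓ : Level} (G : FiniteGroup c ℓ) where
  open FiniteGroup G

  pow : Carrier → ℕ → Carrier
  pow g zero    = ε
  pow g (suc m) = g ∙ pow g m

  -- Least m ≥ start, searching fuel steps, with g^m ≈ ε.
  -- Equality is decided through the bijection with Fin size
  -- (x ≈ y iff to x ≡ to y, as 'to' is part of an inverse pair).
  search : Carrier → ℕ → ℕ → ℕ
  search g zero       m = m
  search g (suc fuel) m with to (pow g m) Fin.≟ to ε
  ... | yes _ = m
  ... | no  _ = search g fuel (suc m)

  -- The order of g: the least positive m with g^m ≈ ε.
  -- (In a finite group of order N such m exists and is ≤ N, so the search
  -- over 1..N finds it.)
  order : Carrier → ℕ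
  order g = search g size 1

  B : ℕ → ℕ
  B n = length (filter (λ i → n ≤? order (from i)) (allFin size))

  IsCyclic : Set (c ⊔ ℓ)
  IsCyclic = ∃ λ g → ∀ x → ∃ λ (i : ℕ) → x ≈ pow g i

-- Let Bᶜ(n) = |G| − B_G(n) count the elements of order less than n; it suffices to show
-- Bᶜ_C(n) ≤ Bᶜ_G(n). By Lagrange's theorem every order in a group of order p^k is a power of p,
-- so when p^b < n ≤ p^(b+1) an element has order < n exactly when its order divides p^b.
-- In the cyclic group C = ⟨g⟩ such elements lie among the p^b powers g^(t·p^(k−b)). In G, either
-- some element h has order divisible by p^b, and then the p^b powers h^(t·ord(h)/p^b) qualify,
-- or every order is below p^b and all |G| ≥ p^b elements qualify.
module Submission where

open import Defs
open import Level using (Level; 0ℓ)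
open import Data.Nat using (ℕ; _≤_; _^_; _>_)
open import Data.Nat.Primality using (Prime)
open import Relation.Binary.PropositionalEquality using (_≡_)

open import Data.Nat
  using ( zero; suc; pred; _+_; _*_; _∸_; _<_; s≤s; z<s; _%_; _/_; _≤?_
        ; NonZero; >-nonZero; >-nonZero⁻¹; nonTrivial⇒n>1)
open import Data.Nat.Properties
open import Data.Fin as Fin using (Fin; toℕ; fromℕ<)
import Data.Fin.Properties as Fin
open import Data.List using (List; []; _∷_; length; filter; lookup; allFin)
open import Data.List.Properties
  using (length-filter; length-tabulate; filter-none; filter-all)
open import Data.List.Membership.Propositional using (_∈_)
open import Data.List.Membership.Propositional.Properties
  using (∈-filter⁺; ∈-filter⁻; ∈-lookup; ∈-allFin)
import Data.List.Relation.Unary.All as All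
import Data.List.Relation.Unary.All.Properties as All
open import Data.List.Relation.Unary.AllPairs using (_∷_)
import Data.List.Relation.Unary.Any as Any
open import Data.List.Relation.Unary.Any.Properties using (lookup-index)
open import Data.List.Relation.Unary.Unique.Propositional using (Unique)
import Data.List.Relation.Unary.Unique.Propositional.Properties as Unique
open import Data.Product using (∃; _×_; _,_; proj₁; proj₂)
open import Data.Nat.Divisibility
  using ( _∣_; divides; quotient; _∣?_; ∣1⇒≡1; *-cancelʳ-∣; m%n≡0⇒n∣m; m∣n⇒n≡quotient*m
        ; _∣0; ∣-refl; ∣m∣n⇒∣m+n)
open import Data.Nat.DivMod using (m≡m%n+[m/n]*n; m%n<n)
open import Data.Nat.Coprimality as Coprime using (Coprime; coprime-divisor)
open import Data.Nat.Primality using (prime⇒irreducible; prime⇒nonZero; prime⇒nonTrivial)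
open import Data.Sum using (_⊎_; inj₁; inj₂)
open import Data.Empty using (⊥-elim)
open import Relation.Nullary using (¬_; yes; no)
open import Function.Bundles using (Inverse; Injection)
open import Function.Properties.Inverse using (Inverse⇒Injection)
open import Relation.Binary.Definitions using (tri<; tri≈; tri>)
open import Relation.Unary using (Pred; Decidable; ∁)
open import Relation.Unary.Properties using (_∩?_; ∁?; U?)
open import Data.Unit using (tt)
open import Induction.WellFounded using (Acc; acc)
open import Data.Nat.Induction using (<-wellFounded)
open import Relation.Binary.PropositionalEquality as ≡
  using (cong; module ≡-Reasoning)

count : ∀ {a p} {A : Set a} {P : Pred A p} → Decidable P → List A → ℕ
count P? xs = length (filter P? xs)

module _ {a p} {A : Set a} {P : Pred A p} (P? : Decidable P) where

  injective⇒≤count : ∀ {m} {xs : List A} (f : Fin m → A) →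
                     (∀ {i j} → f i ≡ f j → i ≡ j) →
                     (∀ i → f i ∈ xs) → (∀ i → P (f i)) → m ≤ count P? xs
  injective⇒≤count {xs = xs} f f-inj f∈xs Pf = Fin.injective⇒≤ position-injective
    where
    position : ∀ i → f i ∈ filter P? xs
    position i = ∈-filter⁺ P? (f∈xs i) (Pf i)
    position-injective : ∀ {i j} → Any.index (position i) ≡ Any.index (position j) → i ≡ j
    position-injective {i} {j} eq = f-inj (begin
      f i                                          ≡⟨ lookup-index (position i) ⟩
      lookup (filter P? xs) (Any.index (position i)) ≡⟨ cong (lookup (filter P? xs)) eq ⟩
      lookup (filter P? xs) (Any.index (position j)) ≡⟨ lookup-index (position j) ⟨
      f j                                          ∎)
      where open ≡-Reasoning

  count+count-∁≡length : ∀ xs → count P? xs + count (∁? P?) xs ≡ length xs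
  count+count-∁≡length [] = ≡.refl
  count+count-∁≡length (x ∷ xs) with P? x
  ... | yes _ = cong suc (count+count-∁≡length xs)
  ... | no  _ = ≡.trans (+-suc _ _) (cong suc (count+count-∁≡length xs))

  module _ {q} {Q : Pred A q} (Q? : Decidable Q) where

    count-∩+count-∖ : ∀ xs → count P? xs ≡ count (P? ∩? Q?) xs + count (P? ∩? ∁? Q?) xs
    count-∩+count-∖ [] = ≡.refl
    count-∩+count-∖ (x ∷ xs) with P? x | Q? x
    ... | yes _ | yes _ = cong suc (count-∩+count-∖ xs)
    ... | yes _ | no  _ = ≡.trans (cong suc (count-∩+count-∖ xs)) (≡.sym (+-suc _ _))
    ... | no  _ | yes _ = count-∩+count-∖ xs
    ... | no  _ | no  _ = count-∩+count-∖ xs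

lookup-injective : ∀ {a} {A : Set a} {xs : List A} → Unique xs →
                   ∀ {i j} → lookup xs i ≡ lookup xs j → i ≡ j
lookup-injective (_ ∷ _) {Fin.zero} {Fin.zero} _ = ≡.refl
lookup-injective (x∉ ∷ _) {Fin.zero} {Fin.suc j} eq = ⊥-elim (All.lookup x∉ (∈-lookup j) eq)
lookup-injective (x∉ ∷ _) {Fin.suc i} {Fin.zero} eq = ⊥-elim (All.lookup x∉ (∈-lookup i) (≡.sym eq))
lookup-injective (_ ∷ u) {Fin.suc i} {Fin.suc j} eq = cong Fin.suc (lookup-injective u eq)

covered⇒count≤ : ∀ {a p} {A : Set a} {P : Pred A p} (P? : Decidable P) {xs : List A} →
                 Unique xs → ∀ {m} (f : Fin m → A) →
                 (∀ {y} → y ∈ xs → P y → ∃ λ i → f i ≡ y) → count P? xs ≤ m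
covered⇒count≤ P? {xs} u f covers = Fin.injective⇒≤ preimage-injective
  where
  preimage : ∀ k → ∃ λ i → f i ≡ lookup (filter P? xs) k
  preimage k = let y∈xs , Py = ∈-filter⁻ P? (∈-lookup k) in covers y∈xs Py
  preimage-injective : ∀ {k l} → proj₁ (preimage k) ≡ proj₁ (preimage l) → k ≡ l
  preimage-injective {k} {l} eq = lookup-injective (Unique.filter⁺ P? u)
    (≡.trans (≡.sym (proj₂ (preimage k))) (≡.trans (cong f eq) (proj₂ (preimage l))))

^-cancelˡ-< : ∀ m {n o} → 1 < m → m ^ n < m ^ o → n < o
^-cancelˡ-< m 1<m mⁿ<mᵒ = ≰⇒> λ o≤n → <⇒≱ mⁿ<mᵒ (^-monoʳ-≤ m {{>-nonZero (<-trans z<s 1<m)}} o≤n)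

^-cancelˡ-≤ : ∀ m {n o} → 1 < m → m ^ n ≤ m ^ o → n ≤ o
^-cancelˡ-≤ m 1<m mⁿ≤mᵒ = ≮⇒≥ λ o<n → <⇒≱ (^-monoʳ-< m 1<m o<n) mⁿ≤mᵒ

^-monoʳ-∣ : ∀ m {n o} → n ≤ o → m ^ n ∣ m ^ o
^-monoʳ-∣ m {n} {o} n≤o = divides (m ^ (o ∸ n)) (begin
  m ^ o               ≡⟨ cong (m ^_) (m∸n+n≡m n≤o) ⟨
  m ^ (o ∸ n + n)     ≡⟨ ^-distribˡ-+-* m (o ∸ n) n ⟩
  m ^ (o ∸ n) * m ^ n ∎)
  where open ≡-Reasoning

module _ {p} (p-prime : Prime p) where

  ¬∣⇒coprime : ∀ {d} → ¬ p ∣ d → Coprime p d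
  ¬∣⇒coprime p∤d (e∣p , e∣d) with prime⇒irreducible p-prime e∣p
  ... | inj₁ e≡1   = e≡1
  ... | inj₂ ≡.refl = ⊥-elim (p∤d e∣d)

  ∣p^⇒≡p^ : ∀ k {d} → d ∣ p ^ k → ∃ λ e → d ≡ p ^ e
  ∣p^⇒≡p^ zero    d∣1 = 0 , ∣1⇒≡1 d∣1
  ∣p^⇒≡p^ (suc k) {d} d∣p^1+k with p ∣? d
  ... | no  p∤d = ∣p^⇒≡p^ k (coprime-divisor (Coprime.sym (¬∣⇒coprime p∤d)) d∣p^1+k)
  ... | yes (divides q ≡.refl) with ∣p^⇒≡p^ k {q} (*-cancelʳ-∣ p {{prime⇒nonZero p-prime}}
                                    (≡.subst (q * p ∣_) (*-comm p (p ^ k)) d∣p^1+k))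
  ...   | e , ≡.refl = suc e , *-comm (p ^ e) p

module FiniteGroupTheory {c ℓ} (G : FiniteGroup c ℓ) where

  open FiniteGroup G
  open Inverse enum using (to-cong; strictlyInverseˡ; strictlyInverseʳ)
  open import Algebra.Properties.Group group using (∙-cancelˡ; ∙-cancelʳ)
  open import Algebra.Properties.Monoid.Mult monoid renaming (_×_ to _×ᵍ_)
    using (×-congʳ; ×-homo-+; ×-assocˡ)
  open import Relation.Binary.Reasoning.Setoid setoid

  to-injective : ∀ {x y} → to x ≡ to y → x ≈ y
  to-injective = Injection.injective (Inverse⇒Injection enum)

  from≈⇒to≡ : ∀ {j y} → from j ≈ y → to y ≡ j
  from≈⇒to≡ {j} from-j≈y = ≡.trans (to-cong (sym from-j≈y)) (strictlyInverseˡ j)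

  from-injective : ∀ {j k} → from j ≈ from k → j ≡ k
  from-injective {j} {k} from-j≈from-k =
    ≡.trans (≡.sym (from≈⇒to≡ from-j≈from-k)) (strictlyInverseˡ k)

  infixr 8 _^ᵍ_
  _^ᵍ_ : Carrier → ℕ → Carrier
  _^ᵍ_ = pow G

  ^ᵍ≡× : ∀ g m → g ^ᵍ m ≡ m ×ᵍ g
  ^ᵍ≡× g zero    = ≡.refl
  ^ᵍ≡× g (suc m) = cong (g ∙_) (^ᵍ≡× g m)

  ^ᵍ-congˡ : ∀ {g h} m → g ≈ h → g ^ᵍ m ≈ h ^ᵍ m
  ^ᵍ-congˡ {g} {h} m g≈h rewrite ^ᵍ≡× g m | ^ᵍ≡× h m = ×-congʳ m g≈h

  ^ᵍ-+ : ∀ g m n → g ^ᵍ (m + n) ≈ g ^ᵍ m ∙ g ^ᵍ n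
  ^ᵍ-+ g m n rewrite ^ᵍ≡× g (m + n) | ^ᵍ≡× g m | ^ᵍ≡× g n = ×-homo-+ g m n

  ^ᵍ-* : ∀ g m n → (g ^ᵍ m) ^ᵍ n ≈ g ^ᵍ (n * m)
  ^ᵍ-* g m n rewrite ^ᵍ≡× (g ^ᵍ m) n | ^ᵍ≡× g m | ^ᵍ≡× g (n * m) = ×-assocˡ g n m

  ^ᵍ-∸ : ∀ g {m n} → m ≤ n → g ^ᵍ m ≈ g ^ᵍ n → g ^ᵍ (n ∸ m) ≈ ε
  ^ᵍ-∸ g {m} {n} m≤n gᵐ≈gⁿ = ∙-cancelʳ (g ^ᵍ m) _ _ (begin
    g ^ᵍ (n ∸ m) ∙ g ^ᵍ m ≈⟨ ^ᵍ-+ g (n ∸ m) m ⟨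
    g ^ᵍ (n ∸ m + m)      ≡⟨ cong (g ^ᵍ_) (m∸n+n≡m m≤n) ⟩
    g ^ᵍ n                ≈⟨ gᵐ≈gⁿ ⟨
    g ^ᵍ m                ≈⟨ identityˡ _ ⟨
    ε ∙ g ^ᵍ m            ∎)

  ε^ᵍ : ∀ m → ε ^ᵍ m ≈ ε
  ε^ᵍ zero    = refl
  ε^ᵍ (suc m) = trans (identityˡ _) (ε^ᵍ m)

  ord : Carrier → ℕ
  ord = order G

  module _ (g : Carrier) where

    search-≥ : ∀ fuel m → m ≤ search G g fuel m
    search-≥ zero       m = ≤-refl
    search-≥ (suc fuel) m with to (g ^ᵍ m) Fin.≟ to ε
    ... | yes _ = ≤-refl
    ... | no  _ = ≤-trans (n≤1+n m) (search-≥ fuel (suc m))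

    search-minimal : ∀ fuel m {t} → m ≤ t → t < search G g fuel m → ¬ g ^ᵍ t ≈ ε
    search-minimal zero       m m≤t t<s = ⊥-elim (<⇒≱ t<s m≤t)
    search-minimal (suc fuel) m {t} m≤t t<s with to (g ^ᵍ m) Fin.≟ to ε
    ... | yes _ = ⊥-elim (<⇒≱ t<s m≤t)
    ... | no gᵐ≉ε with m ≟ t
    ...   | yes ≡.refl = λ gᵐ≈ε → gᵐ≉ε (to-cong gᵐ≈ε)
    ...   | no  m≢t    = search-minimal fuel (suc m) (≤∧≢⇒< m≤t m≢t) t<s

    search-found-or-exhausted : ∀ fuel m →
      g ^ᵍ search G g fuel m ≈ ε ⊎ search G g fuel m ≡ m + fuel
    search-found-or-exhausted zero       m = inj₂ (≡.sym (+-identityʳ m))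
    search-found-or-exhausted (suc fuel) m with to (g ^ᵍ m) Fin.≟ to ε
    ... | yes gᵐ≡ε = inj₁ (to-injective gᵐ≡ε)
    ... | no  _ with search-found-or-exhausted fuel (suc m)
    ...   | inj₁ found     = inj₁ found
    ...   | inj₂ exhausted = inj₂ (≡.trans exhausted (≡.sym (+-suc m fuel)))

    ∃^ᵍ≈ε : ∃ λ m → 0 < m × m ≤ size × g ^ᵍ m ≈ ε
    ∃^ᵍ≈ε with Fin.pigeonhole (n<1+n size) (λ (i : Fin (suc size)) → to (g ^ᵍ toℕ i))
    ... | i , j , i<j , gⁱ≡gʲ = toℕ j ∸ toℕ i , m<n⇒0<n∸m i<j ,
      ≤-trans (m∸n≤m (toℕ j) (toℕ i)) (Fin.toℕ≤pred[n] j) , ^ᵍ-∸ g (<⇒≤ i<j) (to-injective gⁱ≡gʲ)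

    order-pos : 0 < ord g
    order-pos = search-≥ size 1

    order-minimal : ∀ {t} → 0 < t → t < ord g → ¬ g ^ᵍ t ≈ ε
    order-minimal = search-minimal size 1

    order-≤ : ∀ {t} → 0 < t → g ^ᵍ t ≈ ε → ord g ≤ t
    order-≤ 0<t gᵗ≈ε = ≮⇒≥ λ t<ord → order-minimal 0<t t<ord gᵗ≈ε

    ^ᵍ-order : g ^ᵍ ord g ≈ ε
    ^ᵍ-order with ∃^ᵍ≈ε | search-found-or-exhausted size 1
    ... | _ , _ , _ , _ | inj₁ found = found
    ... | m , 0<m , m≤size , gᵐ≈ε | inj₂ exhausted =
      ⊥-elim (order-minimal 0<m (≡.subst (m <_) (≡.sym exhausted) (s≤s m≤size)) gᵐ≈ε)

    order≤size : ord g ≤ size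
    order≤size = let m , 0<m , m≤size , gᵐ≈ε = ∃^ᵍ≈ε in ≤-trans (order-≤ 0<m gᵐ≈ε) m≤size

  instance
    order-nonZero : ∀ {g} → NonZero (ord g)
    order-nonZero {g} = >-nonZero (order-pos g)

  module _ (g : Carrier) where

    ^ᵍ-*order : ∀ q → g ^ᵍ (q * ord g) ≈ ε
    ^ᵍ-*order q = begin
      g ^ᵍ (q * ord g)   ≈⟨ ^ᵍ-* g (ord g) q ⟨
      (g ^ᵍ ord g) ^ᵍ q  ≈⟨ ^ᵍ-congˡ q (^ᵍ-order g) ⟩
      ε ^ᵍ q             ≈⟨ ε^ᵍ q ⟩
      ε                  ∎

    ^ᵍ-order+ : ∀ t → g ^ᵍ (ord g + t) ≈ g ^ᵍ t
    ^ᵍ-order+ t = begin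
      g ^ᵍ (ord g + t)     ≈⟨ ^ᵍ-+ g (ord g) t ⟩
      g ^ᵍ ord g ∙ g ^ᵍ t  ≈⟨ ∙-congʳ (^ᵍ-order g) ⟩
      ε ∙ g ^ᵍ t           ≈⟨ identityˡ _ ⟩
      g ^ᵍ t               ∎

    ^ᵍ-mod : ∀ i → g ^ᵍ i ≈ g ^ᵍ (i % ord g)
    ^ᵍ-mod i = begin
      g ^ᵍ i                                       ≡⟨ cong (g ^ᵍ_) (m≡m%n+[m/n]*n i (ord g)) ⟩
      g ^ᵍ (i % ord g + i / ord g * ord g)         ≈⟨ ^ᵍ-+ g (i % ord g) (i / ord g * ord g) ⟩
      g ^ᵍ (i % ord g) ∙ g ^ᵍ (i / ord g * ord g)  ≈⟨ ∙-congˡ (^ᵍ-*order (i / ord g)) ⟩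
      g ^ᵍ (i % ord g) ∙ ε                         ≈⟨ identityʳ _ ⟩
      g ^ᵍ (i % ord g)                             ∎

    order∣ : ∀ {m} → g ^ᵍ m ≈ ε → ord g ∣ m
    order∣ {m} gᵐ≈ε = m%n≡0⇒n∣m m (ord g) (n≤0⇒n≡0 (≮⇒≥ λ 0<m%o →
      order-minimal g 0<m%o (m%n<n m (ord g)) (trans (sym (^ᵍ-mod m)) gᵐ≈ε)))

    order∣⇒^ᵍ≈ε : ∀ {m} → ord g ∣ m → g ^ᵍ m ≈ ε
    order∣⇒^ᵍ≈ε (divides q ≡.refl) = ^ᵍ-*order q

    ^ᵍ-distinct : ∀ {m n} → m < n → n < ord g → ¬ g ^ᵍ m ≈ g ^ᵍ n
    ^ᵍ-distinct {m} {n} m<n n<o gᵐ≈gⁿ =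
      order-minimal g (m<n⇒0<n∸m m<n) (≤-<-trans (m∸n≤m n m) n<o) (^ᵍ-∸ g (<⇒≤ m<n) gᵐ≈gⁿ)

    ^ᵍ-injective : ∀ {m n} → m < ord g → n < ord g → g ^ᵍ m ≈ g ^ᵍ n → m ≡ n
    ^ᵍ-injective {m} {n} m<o n<o gᵐ≈gⁿ with <-cmp m n
    ... | tri< m<n _ _ = ⊥-elim (^ᵍ-distinct m<n n<o gᵐ≈gⁿ)
    ... | tri≈ _ m≡n _ = m≡n
    ... | tri> _ _ n<m = ⊥-elim (^ᵍ-distinct n<m m<o (sym gᵐ≈gⁿ))

  module Lagrange (x : Carrier) where

    Closed : Pred (Fin size) 0ℓ → Set
    Closed S = ∀ {j} → S j → S (to (x ∙ from j))

    Coset : Carrier → Pred (Fin size) 0ℓ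
    Coset a j = ∃ λ (i : Fin (ord x)) → to (x ^ᵍ toℕ i ∙ a) ≡ j

    coset? : ∀ a → Decidable (Coset a)
    coset? a j = Fin.any? λ i → to (x ^ᵍ toℕ i ∙ a) Fin.≟ j

    ∈coset : ∀ {a j} t → from j ≈ x ^ᵍ t ∙ a → Coset a j
    ∈coset {a} t from-j≈xᵗa = fromℕ< t%o<o ,
      ≡.trans (cong (λ m → to (x ^ᵍ m ∙ a)) (Fin.toℕ-fromℕ< t%o<o))
              (from≈⇒to≡ (trans from-j≈xᵗa (∙-congʳ (^ᵍ-mod x t))))
      where t%o<o = m%n<n t (ord x)

    -- The exponent ord x - 1 + i undoes the extra factor x, as x ^ ord x ≈ ε.
    ∁coset-closed : ∀ a → Closed (∁ (Coset a))
    ∁coset-closed a {j} j∉coset (i , xⁱa≡xj) = j∉coset (∈coset (pred (ord x) + toℕ i)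
      (∙-cancelˡ x _ _ (begin
        x ∙ from j                           ≈⟨ to-injective xⁱa≡xj ⟨
        x ^ᵍ toℕ i ∙ a                       ≈⟨ ∙-congʳ (^ᵍ-order+ x (toℕ i)) ⟨
        x ^ᵍ (ord x + toℕ i) ∙ a             ≡⟨ cong (λ o → x ^ᵍ (o + toℕ i) ∙ a) (suc-pred _) ⟨
        x ∙ x ^ᵍ (pred (ord x) + toℕ i) ∙ a  ≈⟨ assoc _ _ _ ⟩
        x ∙ (x ^ᵍ (pred (ord x) + toℕ i) ∙ a) ∎)))

    module _ {S : Pred (Fin size) 0ℓ} (S? : Decidable S) (closed : Closed S)
             {a : Carrier} (S∋a : S (to a)) where

      translate : Fin (ord x) → Fin size
      translate i = to (x ^ᵍ toℕ i ∙ a)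

      translate-injective : ∀ {i k} → translate i ≡ translate k → i ≡ k
      translate-injective eq = Fin.toℕ-injective
        (^ᵍ-injective x (Fin.toℕ<n _) (Fin.toℕ<n _) (∙-cancelʳ a _ _ (to-injective eq)))

      S∋xᵗa : ∀ t → S (to (x ^ᵍ t ∙ a))
      S∋xᵗa zero    = ≡.subst S (to-cong (sym (identityˡ a))) S∋a
      S∋xᵗa (suc t) = ≡.subst S (to-cong (trans (∙-congˡ (strictlyInverseʳ _)) (sym (assoc _ _ _))))
                              (closed (S∋xᵗa t))

      count-coset : count (S? ∩? coset? a) (allFin size) ≡ ord x
      count-coset = ≤-antisym
        (covered⇒count≤ (S? ∩? coset? a) (Unique.allFin⁺ size) translate λ _ (_ , ∈coset) → ∈coset)
        (injective⇒≤count (S? ∩? coset? a) translate translate-injective (λ _ → ∈-allFin _)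
                          (λ i → S∋xᵗa (toℕ i) , i , ≡.refl))

    -- Peel off one coset at a time; what is left is again closed.
    order∣count : ∀ {S : Pred (Fin size) 0ℓ} (S? : Decidable S) →
                  Acc _<_ (count S? (allFin size)) → Closed S → ord x ∣ count S? (allFin size)
    order∣count {S} S? (acc rec) closed with Fin.any? S?
    ... | no ∄S = ≡.subst (ord x ∣_) (≡.sym count≡0) (ord x ∣0)
      where
      count≡0 : count S? (allFin size) ≡ 0
      count≡0 = cong length (filter-none S? (All.tabulate⁺ λ i S∋i → ∄S (i , S∋i)))
    ... | yes (j , S∋j) = ≡.subst (ord x ∣_) (≡.sym count≡) (∣m∣n⇒∣m+n ∣-refl
          (order∣count rest? (rec rest<count) λ (S∋k , k∉coset) →
                                                  closed S∋k , ∁coset-closed a k∉coset))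
      where
      a = from j
      rest? = S? ∩? ∁? (coset? a)
      count≡ : count S? (allFin size) ≡ ord x + count rest? (allFin size)
      count≡ = ≡.trans (count-∩+count-∖ S? (coset? a) (allFin size))
        (cong (_+ count rest? (allFin size))
              (count-coset S? closed (≡.subst S (≡.sym (strictlyInverseˡ j)) S∋j)))
      rest<count : count rest? (allFin size) < count S? (allFin size)
      rest<count = ≡.subst (count rest? (allFin size) <_) (≡.sym count≡) (m<n+m _ (order-pos x))

  lagrange : ∀ x → ord x ∣ size
  lagrange x = ≡.subst (ord x ∣_) count-U≡size
    (Lagrange.order∣count x U? (<-wellFounded _) (λ _ → tt))
    where
    count-U≡size : count U? (allFin size) ≡ size
    count-U≡size = ≡.trans (cong length (filter-all U? (All.universal (λ _ → tt) (allFin size))))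
                           (length-tabulate {n = size} (λ i → i))

  order≥? : ∀ n → Decidable λ i → n ≤ ord (from i)
  order≥? n i = n ≤? ord (from i)

  Bᶜ : ℕ → ℕ
  Bᶜ n = count (∁? (order≥? n)) (allFin size)

  B+Bᶜ≡size : ∀ n → B G n + Bᶜ n ≡ size
  B+Bᶜ≡size n = ≡.trans (count+count-∁≡length (order≥? n) (allFin size))
                        (length-tabulate {n = size} (λ i → i))

  Bᶜ≤size : ∀ n → Bᶜ n ≤ size
  Bᶜ≤size n = ≤-trans (length-filter (∁? (order≥? n)) (allFin size))
                      (≤-reflexive (length-tabulate {n = size} (λ i → i)))

  Bᶜ≡0 : ∀ {n} → n ≤ 1 → Bᶜ n ≡ 0
  Bᶜ≡0 {n} n≤1 = cong length (filter-none (∁? (order≥? n))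
    (All.tabulate⁺ λ i n≰ord → n≰ord (≤-trans n≤1 (order-pos (from i)))))

  size≤Bᶜ : ∀ {n} → (∀ i → ord (from i) < n) → size ≤ Bᶜ n
  size≤Bᶜ {n} all<n =
    injective⇒≤count (∁? (order≥? n)) (λ i → i) (λ eq → eq) ∈-allFin (λ i → <⇒≱ (all<n i))

  ∣order⇒≤Bᶜ : ∀ {m n h} → m ∣ ord h → m < n → m ≤ Bᶜ n
  ∣order⇒≤Bᶜ {m} {n} {h} (divides s ord≡s*m) m<n =
    injective⇒≤count (∁? (order≥? n)) f f-injective (λ _ → ∈-allFin _) f-small
    where
    instance
      s*m-nonZero : NonZero (s * m)
      s*m-nonZero = ≡.subst NonZero ord≡s*m order-nonZero
      s-nonZero : NonZero s
      s-nonZero = m*n≢0⇒m≢0 s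
      m-nonZero : NonZero m
      m-nonZero = m*n≢0⇒n≢0 s

    f : Fin m → Fin size
    f t = to (h ^ᵍ (toℕ t * s))

    t*s<ord : ∀ t → toℕ t * s < ord h
    t*s<ord t = ≡.subst (toℕ t * s <_) (≡.trans (*-comm m s) (≡.sym ord≡s*m))
                        (*-monoˡ-< s {toℕ t} {m} (Fin.toℕ<n t))

    f-injective : ∀ {t u} → f t ≡ f u → t ≡ u
    f-injective {t} {u} eq = Fin.toℕ-injective
      (*-cancelʳ-≡ (toℕ t) (toℕ u) s (^ᵍ-injective h (t*s<ord t) (t*s<ord u) (to-injective eq)))

    f-small : ∀ t → ¬ n ≤ ord (from (f t))
    f-small t = <⇒≱ (≤-<-trans (order-≤ (from (f t)) (>-nonZero⁻¹ m) (begin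
      from (f t) ^ᵍ m            ≈⟨ ^ᵍ-congˡ m (strictlyInverseʳ _) ⟩
      (h ^ᵍ (toℕ t * s)) ^ᵍ m    ≈⟨ ^ᵍ-* h (toℕ t * s) m ⟩
      h ^ᵍ (m * (toℕ t * s))     ≡⟨ cong (h ^ᵍ_) (≡.trans (*-comm m _) (*-assoc (toℕ t) s m)) ⟩
      h ^ᵍ (toℕ t * (s * m))     ≡⟨ cong (λ o → h ^ᵍ (toℕ t * o)) ord≡s*m ⟨
      h ^ᵍ (toℕ t * ord h)       ≈⟨ ^ᵍ-*order h (toℕ t) ⟩
      ε                          ∎)) m<n)

  module Cyclic (cyclic : IsCyclic G) where

    generator : Carrier
    generator = proj₁ cyclic

    private
      g = generator

    log : Carrier → ℕ
    log y = proj₁ (proj₂ cyclic y) % ord g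

    log<order : ∀ y → log y < ord g
    log<order y = m%n<n _ (ord g)

    ≈^ᵍlog : ∀ y → y ≈ g ^ᵍ log y
    ≈^ᵍlog y = trans (proj₂ (proj₂ cyclic y)) (^ᵍ-mod g _)

    order-generator : ord g ≡ size
    order-generator = ≤-antisym (order≤size g) (Fin.injective⇒≤ index-log-injective)
      where
      index-log : Fin size → Fin (ord g)
      index-log j = fromℕ< (log<order (from j))
      index-log-injective : ∀ {j k} → index-log j ≡ index-log k → j ≡ k
      index-log-injective {j} {k} eq = from-injective (begin
        from j              ≈⟨ ≈^ᵍlog (from j) ⟩
        g ^ᵍ log (from j)   ≡⟨ cong (g ^ᵍ_) (Fin.fromℕ<-injective _ _ _ _ eq) ⟩
        g ^ᵍ log (from k)   ≈⟨ ≈^ᵍlog (from k) ⟨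
        from k              ∎)

    -- If y = g ^ r and y ^ m ≈ ε then q · m = size ∣ r · m, so y = g ^ (t · q) with t < m.
    Bᶜ≤divisor : ∀ {m n} → m ∣ size → (∀ y → ord y < n → ord y ∣ m) → Bᶜ n ≤ m
    Bᶜ≤divisor {m} {n} (divides q size≡q*m) small∣m =
      covered⇒count≤ (∁? (order≥? n)) (Unique.allFin⁺ size) (λ t → to (g ^ᵍ (toℕ t * q))) covered
      where
      ord≡q*m : ord g ≡ q * m
      ord≡q*m = ≡.trans order-generator size≡q*m

      instance
        q*m-nonZero : NonZero (q * m)
        q*m-nonZero = ≡.subst NonZero ord≡q*m order-nonZero
        m-nonZero : NonZero m
        m-nonZero = m*n≢0⇒n≢0 q

      covered : ∀ {j} → j ∈ allFin size → ¬ n ≤ ord (from j) → ∃ λ t → to (g ^ᵍ (toℕ t * q)) ≡ j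
      covered {j} _ n≰ord = fromℕ< t<m ,
        ≡.trans (cong (λ e → to (g ^ᵍ e)) (≡.trans (cong (_* q) (Fin.toℕ-fromℕ< t<m)) (≡.sym r≡t*q)))
          (from≈⇒to≡ (≈^ᵍlog y))
        where
        y = from j
        r = log y
        g^[m*r]≈ε : g ^ᵍ (m * r) ≈ ε
        g^[m*r]≈ε = begin
          g ^ᵍ (m * r)   ≈⟨ ^ᵍ-* g r m ⟨
          (g ^ᵍ r) ^ᵍ m  ≈⟨ ^ᵍ-congˡ m (≈^ᵍlog y) ⟨
          y ^ᵍ m         ≈⟨ order∣⇒^ᵍ≈ε y (small∣m y (≰⇒> n≰ord)) ⟩
          ε              ∎
        q∣r : q ∣ r
        q∣r = *-cancelʳ-∣ m (≡.subst₂ _∣_ ord≡q*m (*-comm m r) (order∣ g g^[m*r]≈ε))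
        t = quotient q∣r
        r≡t*q : r ≡ t * q
        r≡t*q = m∣n⇒n≡quotient*m q∣r
        t<m : t < m
        t<m = *-cancelʳ-< q t m (≡.subst₂ _<_ r≡t*q (≡.trans ord≡q*m (*-comm q m)) (log<order y))

module PGroup {c ℓ p k} (p-prime : Prime p)
              (G : FiniteGroup c ℓ) (size≡p^k : FiniteGroup.size G ≡ p ^ k) where

  open FiniteGroup G
  open FiniteGroupTheory G

  private
    1<p : 1 < p
    1<p = nonTrivial⇒n>1 p {{prime⇒nonTrivial p-prime}}

  order≡p^ : ∀ x → ∃ λ e → ord x ≡ p ^ e
  order≡p^ x = ∣p^⇒≡p^ p-prime k (≡.subst (ord x ∣_) size≡p^k (lagrange x))

  p^b≤Bᶜ : ∀ {b n} → b ≤ k → p ^ b < n → p ^ b ≤ Bᶜ n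
  p^b≤Bᶜ {b} {n} b≤k p^b<n with Fin.any? (λ i → p ^ b ≤? ord (from i))
  ... | no ∄i = ≤-trans p^b≤size (size≤Bᶜ λ i → <-trans (≰⇒> λ p^b≤ord → ∄i (i , p^b≤ord)) p^b<n)
    where
    p^b≤size : p ^ b ≤ size
    p^b≤size = ≡.subst (p ^ b ≤_) (≡.sym size≡p^k) (^-monoʳ-≤ p {{prime⇒nonZero p-prime}} b≤k)
  ... | yes (i , p^b≤ord) with order≡p^ (from i)
  ...   | e , ord≡p^e = ∣order⇒≤Bᶜ (≡.subst (p ^ b ∣_) (≡.sym ord≡p^e) (^-monoʳ-∣ p b≤e)) p^b<n
    where
    b≤e : b ≤ e
    b≤e = ^-cancelˡ-≤ p 1<p (≡.subst (p ^ b ≤_) ord≡p^e p^b≤ord)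

  Bᶜ≤p^b : IsCyclic G → ∀ {b n} → b ≤ k → n ≤ p ^ suc b → Bᶜ n ≤ p ^ b
  Bᶜ≤p^b cyclic {b} {n} b≤k n≤p^1+b =
    Cyclic.Bᶜ≤divisor cyclic (≡.subst (p ^ b ∣_) (≡.sym size≡p^k) (^-monoʳ-∣ p b≤k)) small∣p^b
    where
    small∣p^b : ∀ y → ord y < n → ord y ∣ p ^ b
    small∣p^b y ord<n with order≡p^ y
    ... | e , ord≡p^e = ≡.subst (_∣ p ^ b) (≡.sym ord≡p^e) (^-monoʳ-∣ p (≤-pred e<1+b))
      where
      e<1+b : e < suc b
      e<1+b = ^-cancelˡ-< p 1<p (<-≤-trans (≡.subst (_< n) ord≡p^e ord<n) n≤p^1+b)

open FiniteGroupTheory using (Bᶜ; B+Bᶜ≡size; Bᶜ≤size; Bᶜ≡0; size≤Bᶜ; order≤size)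

bracket-by-powers : ∀ m k {n} → 1 < n → n ≤ m ^ k → ∃ λ b → m ^ b < n × n ≤ m ^ suc b × b ≤ k
bracket-by-powers m zero    1<n n≤1 = ⊥-elim (<⇒≱ 1<n n≤1)
bracket-by-powers m (suc k) {n} 1<n n≤m^1+k with n ≤? m ^ k
... | yes n≤m^k = let b , m^b<n , n≤m^1+b , b≤k = bracket-by-powers m k 1<n n≤m^k
                  in b , m^b<n , n≤m^1+b , m≤n⇒m≤1+n b≤k
... | no  n≰m^k = k , ≰⇒> n≰m^k , n≤m^1+k , n≤1+n k

Bᶜ-cyclic≤Bᶜ : ∀ {c ℓ c′ ℓ′} p k → Prime p →
              (G : FiniteGroup c ℓ) → FiniteGroup.size G ≡ p ^ k →
              (C : FiniteGroup c′ ℓ′) → IsCyclic C → FiniteGroup.size C ≡ p ^ k →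
              ∀ n → Bᶜ C n ≤ Bᶜ G n
Bᶜ-cyclic≤Bᶜ p k p-prime G size-G C cyclic size-C n with n ≤? 1 | n ≤? p ^ k
... | yes n≤1 | _ = ≤-reflexive (≡.trans (Bᶜ≡0 C n≤1) (≡.sym (Bᶜ≡0 G n≤1)))
... | no _ | no n≰p^k = begin
  Bᶜ C n              ≤⟨ Bᶜ≤size C n ⟩
  FiniteGroup.size C  ≡⟨ ≡.trans size-C (≡.sym size-G) ⟩
  FiniteGroup.size G  ≤⟨ size≤Bᶜ G (λ i → ≤-<-trans (order≤size G _) size<n) ⟩
  Bᶜ G n              ∎
  where
  open ≤-Reasoning
  size<n : FiniteGroup.size G < n
  size<n = ≡.subst (_< n) (≡.sym size-G) (≰⇒> n≰p^k)
... | no n≰1 | yes n≤p^k =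
  let b , p^b<n , n≤p^1+b , b≤k = bracket-by-powers p k (≰⇒> n≰1) n≤p^k
  in ≤-trans (PGroup.Bᶜ≤p^b p-prime C size-C cyclic b≤k n≤p^1+b)
             (PGroup.p^b≤Bᶜ p-prime G size-G b≤k p^b<n)

lemma4p1 : ∀ {c ℓ c′ ℓ′ : Level} (p k : ℕ) → Prime p →
           (G : FiniteGroup c ℓ) → FiniteGroup.size G ≡ p ^ k →
           (C : FiniteGroup c′ ℓ′) → IsCyclic C → FiniteGroup.size C ≡ p ^ k →
           (n : ℕ) → n > 0 →
           B G n ≤ B C n
lemma4p1 p k p-prime G size-G C cyclic size-C n _ = +-cancelʳ-≤ (Bᶜ G n) (B G n) (B C n) (begin
  B G n + Bᶜ G n        ≡⟨ B+Bᶜ≡size G n ⟩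
  FiniteGroup.size G    ≡⟨ ≡.trans size-G (≡.sym size-C) ⟩
  FiniteGroup.size C    ≡⟨ B+Bᶜ≡size C n ⟨
  B C n + Bᶜ C n        ≤⟨ +-monoʳ-≤ (B C n) (Bᶜ-cyclic≤Bᶜ p k p-prime G size-G C cyclic size-C n) ⟩
  B C n + Bᶜ G n        ∎)
  where open ≤-Reasoning
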